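{- Let $\emptyset\neq\mathcal{T}=\{T_1,\dots,T_d\}\subset\Sigma_\$^+$, $n=|T_1\cdots T_d|$, and $i,j\in[1..n]$ with $i<j$. Then $\mathrm{lcpcount}(\mathrm{conj}(\mathrm{CA}[i]),\mathrm{conj}(\mathrm{CA}[j]))=\min\{\mathrm{LCP}^\infty_\mathcal{T}[k]:k\in[i+1..j]\}=\mathrm{RNV}(\mathrm{LCP}^\infty_\mathcal{T},i+1,j,-1)$.
   Context: $\Sigma=[0..\sigma]$ integer alphabet, $\$\notin\Sigma$ smaller than every integer, $\Sigma_\$=\Sigma\cup\{\$\}$, $\infty$ larger than every integer. Strings 1-indexed; $X[..i]=X[1..i]$, $X[i..]=X[i..|X|]$; $X^\omega$ infinite concatenation. Every nonempty $X$ is $Y^k$ for a unique primitive $Y=:\mathrm{root}(X)$. $\mathrm{rot}^0(X)=X$, $\mathrm{rot}^{k+1}(X)=\mathrm{rot}^k(X)[2..]\cdot\mathrm{rot}^k(X)[1]$. $\mathrm{lcp}(U,V)$ = longest common prefix length; $U<V$ iff $U$ is a proper prefix of $V$ or $U[\ell+1]<V[\ell+1]$ with $\ell=\mathrm{lcp}(U,V)$. $\mathrm{rank}_c(X,j)$ = occurrences of $c$ in $X[1..j]$. $\mathrm{PD}(V)[i]=\infty$ if $V[i]\neq\$$ and $V[i]<V[j]$ for all $j<i$; $=\$$ if $V[i]=\$$; otherwise $i-\max\{j<i:V[j]\le V[i]\}$. $\mathrm{RPD}(V)=\mathrm{PD}(V^2)[|V|+1..]$. $V\preceq_\omega U$ iff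 some natural $i$ has $\mathrm{PD}(V^\omega[..i])<\mathrm{PD}(U^\omega[..i])$ or $\mathrm{root}(\mathrm{RPD}(V))=\mathrm{root}(\mathrm{RPD}(U))$; $=_\omega$: both directions; $\prec_\omega$: $\preceq_\omega$ and not $=_\omega$. With $n_k=|T_k|$: for $i\in[1..n]$, $j$ minimal with $n_1+\dots+n_j\ge i$, $\mathrm{conj}(i)=\mathrm{rot}^{\,i-1-(n_1+\dots+n_{j-1})}(T_j)$; $\mathrm{CA}[i]=j$ iff $i-1=|\{k:\mathrm{conj}(k)\prec_\omega\mathrm{conj}(j)\text{ or }(\mathrm{conj}(k)=_\omega\mathrm{conj}(j)\wedge k<j)\}|$. $\mathrm{lcpcount}(U,W)=\mathrm{rank}_\infty(\mathrm{PD}(U),\mathrm{lcp}(\mathrm{PD}(U),\mathrm{PD}(W)))$. $\mathrm{LCP}^\infty_\mathcal{T}[1]=0$ and $\mathrm{LCP}^\infty_\mathcal{T}[i]=\mathrm{lcpcount}(\mathrm{conj}(\mathrm{CA}[i]),\mathrm{conj}(\mathrm{CA}[i-1]))$ for $i\in[2..n]$. $\mathrm{RNV}(X,i,j,c)$ is the smallest value in $X[i..j]$ larger than $c$. -}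

module Defs where

open import Data.Bool using (Bool; true; false; if_then_else_)
open import Data.Nat using (ℕ; zero; suc; _+_; _∸_; _≤_; _<_; _≤ᵇ_)
open import Data.Fin using (Fin; toℕ)
open import Data.Integer using (ℤ; +_) renaming (_<_ to _<ℤ_)
open import Data.List using (List; []; _∷_; length; take; drop; concat; replicate; _++_)
open import Data.List.Membership.Propositional using (_∈_)
open import Data.List.Relation.Unary.Unique.Propositional using (Unique)
open import Data.Product using (Σ; ∃; _×_; _,_)
open import Data.Sum using (_⊎_)
open import Relation.Nullary using (¬_)
open import Relation.Binary.PropositionalEquality using (_≡_; _≢_)
open import Function.Bundles using (_⇔_)

-- Alphabet Σ_$ = {$} ∪ Σ, Σ = [0..σ]; $ is smaller than every integer.

data Sym (σ : ℕ) : Set where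
  dol : Sym σ
  chr : Fin (suc σ) → Sym σ

_≤S_ : ∀ {σ} → Sym σ → Sym σ → Bool
dol   ≤S _     = true
chr _ ≤S dol   = false
chr a ≤S chr b = toℕ a ≤ᵇ toℕ b

Str : ℕ → Set
Str σ = List (Sym σ)

data PDSym : Set where
  pdol : PDSym
  pnum : ℕ → PDSym
  pinf : PDSym

data _<P_ : PDSym → PDSym → Set where
  dol<num : ∀ {m} → pdol <P pnum m
  dol<inf : pdol <P pinf
  num<num : ∀ {m k} → m < k → pnum m <P pnum k
  num<inf : ∀ {m} → pnum m <P pinf

isInf : PDSym → Bool
isInf pinf = true
isInf _    = false

eqP : PDSym → PDSym → Bool
eqP pdol     pdol     = true
eqP (pnum m) (pnum k) = (m ≤ᵇ k) Data.Bool.∧ (k ≤ᵇ m)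
eqP pinf     pinf     = true
eqP _        _        = false

-- Position i of V with earlier symbols V[i-1], V[i-2], … (nearest
-- first) in `prev`:
--   V[i] = $                                  ↦ $
--   no j < i with V[j] ≤ V[i]  (V[i] ≠ $)     ↦ ∞
--   otherwise                                 ↦ i - max{ j < i : V[j] ≤ V[i] }

pdSearch : ∀ {σ} → Sym σ → List (Sym σ) → ℕ → PDSym
pdSearch x []         d = pinf
pdSearch x (y ∷ prev) d = if y ≤S x then pnum d else pdSearch x prev (suc d)

pdAt : ∀ {σ} → List (Sym σ) → Sym σ → PDSym
pdAt prev dol       = pdol
pdAt prev (chr a)   = pdSearch (chr a) prev 1

pdGo : ∀ {σ} → List (Sym σ) → Str σ → List PDSym
pdGo prev []       = []
pdGo prev (x ∷ xs) = pdAt prev x ∷ pdGo (x ∷ prev) xs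

PD : ∀ {σ} → Str σ → List PDSym
PD V = pdGo [] V

RPD : ∀ {σ} → Str σ → List PDSym
RPD V = drop (length V) (PD (V ++ V))

pow : ∀ {A : Set} → List A → ℕ → List A
pow X k = concat (replicate k X)

Primitive : ∀ {A : Set} → List A → Set
Primitive {A} Y = Y ≢ [] × (∀ (Z : List A) (k : ℕ) → 2 ≤ k → Y ≢ pow Z k)

IsRoot : ∀ {A : Set} → List A → List A → Set
IsRoot R X = Primitive R × ∃ λ k → X ≡ pow R k

-- root(X) = root(Y)   (the root is unique, so this is equality of roots)
SameRoot : ∀ {A : Set} → List A → List A → Set
SameRoot {A} X Y = ∃ λ (R : List A) → IsRoot R X × IsRoot R Y

-- X^ω[..i]  (for nonempty X)
omegaPrefix : ∀ {A : Set} → List A → ℕ → List A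
omegaPrefix X i = take i (pow X i)

rot : ∀ {A : Set} → ℕ → List A → List A
rot zero    X        = X
rot (suc k) X with rot k X
... | []     = []
... | x ∷ xs = xs ++ (x ∷ [])

data LexLt : List PDSym → List PDSym → Set where
  prefix : ∀ {y ys} → LexLt [] (y ∷ ys)
  here   : ∀ {x y xs ys} → x <P y → LexLt (x ∷ xs) (y ∷ ys)
  there  : ∀ {x xs ys} → LexLt xs ys → LexLt (x ∷ xs) (x ∷ ys)

_⪯ω_ : ∀ {σ} → Str σ → Str σ → Set
V ⪯ω U = (∃ λ i → LexLt (PD (omegaPrefix V i)) (PD (omegaPrefix U i)))
         ⊎ SameRoot (RPD V) (RPD U)

_=ω_ : ∀ {σ} → Str σ → Str σ → Set
V =ω U = (V ⪯ω U) × (U ⪯ω V)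

_≺ω_ : ∀ {σ} → Str σ → Str σ → Set
V ≺ω U = (V ⪯ω U) × ¬ (V =ω U)

lcp : List PDSym → List PDSym → ℕ
lcp []       _        = 0
lcp (_ ∷ _)  []       = 0
lcp (x ∷ xs) (y ∷ ys) = if eqP x y then suc (lcp xs ys) else 0

countInf : List PDSym → ℕ
countInf []       = 0
countInf (x ∷ xs) = if isInf x then suc (countInf xs) else countInf xs

rankInf : List PDSym → ℕ → ℕ
rankInf X j = countInf (take j X)

lcpcount : ∀ {σ} → Str σ → Str σ → ℕ
lcpcount U W = rankInf (PD U) (lcp (PD U) (PD W))

-- Collection 𝒯 = T_1 … T_d (as a list), n = |T_1 ⋯ T_d|, conj(i) (1-based)

totalLength : ∀ {σ} → List (Str σ) → ℕ
totalLength []       = 0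
totalLength (T ∷ Ts) = length T + totalLength Ts

conj : ∀ {σ} → List (Str σ) → ℕ → Str σ
conj []       i = []
conj (T ∷ Ts) i = if i ≤ᵇ length T then rot (i ∸ 1) T else conj Ts (i ∸ length T)

CardIs : ℕ → (ℕ → Set) → ℕ → Set
CardIs n P m = ∃ λ (ks : List ℕ) →
  Unique ks × (∀ k → (k ∈ ks) ⇔ ((1 ≤ k × k ≤ n) × P k)) × length ks ≡ m

IsCA : ∀ {σ} → List (Str σ) → (ℕ → ℕ) → Set
IsCA 𝒯 CA =
  (∀ i → 1 ≤ i → i ≤ n → 1 ≤ CA i × CA i ≤ n) ×
  (∀ i j → 1 ≤ i → i ≤ n → 1 ≤ j → j ≤ n →
     (CA i ≡ j) ⇔ CardIs n (λ k → (conj 𝒯 k ≺ω conj 𝒯 j) ⊎ ((conj 𝒯 k =ω conj 𝒯 j) × k < j)) (i ∸ 1))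
  where n = totalLength 𝒯

-- LCP^∞_𝒯 (1-based; LCP[1] = 0; value at index 0 is irrelevant)
LCPinf : ∀ {σ} → List (Str σ) → (ℕ → ℕ) → ℕ → ℕ
LCPinf 𝒯 CA zero          = 0
LCPinf 𝒯 CA (suc zero)    = 0
LCPinf 𝒯 CA (suc (suc m)) = lcpcount (conj 𝒯 (CA (suc (suc m)))) (conj 𝒯 (CA (suc m)))

IsMinOn : (ℕ → ℕ) → ℕ → ℕ → ℕ → Set
IsMinOn X a b v =
  (∃ λ k → a ≤ k × k ≤ b × X k ≡ v) × (∀ k → a ≤ k → k ≤ b → v ≤ X k)

IsRNV : (ℕ → ℕ) → ℕ → ℕ → ℤ → ℕ → Set
IsRNV X a b c v =
  (∃ λ k → a ≤ k × k ≤ b × X k ≡ v) × (c <ℤ + v) ×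
  (∀ k → a ≤ k → k ≤ b → c <ℤ + X k → v ≤ X k)

-- Write Sω k for the PD array of the length-n prefix of conj(CA[k])^ω. Conjugates whose RPDs
-- have the same root have equal Sω arrays, so a lexicographically smaller Sω array means a
-- ≺ω-smaller conjugate; counting ≺ω-predecessors in the definition of CA then shows that Sω is
-- sorted. Every conjugate has length at most n, and past its first period an ω-prefix PD array
-- contains no ∞, so lcpcount of two conjugates is the number of ∞ in the common prefix of their
-- Sω arrays. In a sorted list the lcp of entries i and j is the minimum of the adjacent lcps in
-- between, and the number of ∞ in a prefix grows with its length, so the same holds for
-- lcpcount; as all values are ≥ 0 > -1, this minimum is also the RNV.

module Submission where

open import Defs
open import Data.Bool using (true; false; if_then_else_; T)
open import Data.Bool.Properties using (T-≡; ¬-not; ∧-comm)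
open import Data.Nat using (ℕ; zero; suc; _+_; _∸_; _*_; _≤_; _<_; _≤ᵇ_; z≤n; s≤s; z<s; _⊓_; _⊔_)
open import Data.Nat.Properties
open import Data.Fin using (toℕ)
open import Data.Integer using (-[1+_])
open import Data.Integer.Base using (-<+)
open import Data.List using (List; []; _∷_; length; take; drop; _++_; _ʳ++_; reverse)
open import Data.List.Properties
  using (++-assoc; ++-identityʳ; length-++-sucʳ; length-++-≤ʳ; ʳ++-defn; take-take; length-take; take++drop≡id)
open import Data.List.Membership.Propositional using (_∈_; _∉_)
open import Data.List.Membership.Propositional.Properties using (∈-++⁻; ∈-∃++)
open import Data.List.Relation.Binary.Subset.Propositional using (_⊆_)
open import Data.List.Relation.Unary.All as All using (All; []; _∷_)
open import Data.List.Relation.Unary.Any using (here; there)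
open import Data.List.Relation.Unary.Any.Properties using (reverse⁺)
open import Data.List.Relation.Unary.Unique.Propositional using (Unique; []; _∷_)
open import Data.Product using (∃; _×_; _,_; proj₁; proj₂)
open import Data.Sum using (_⊎_; inj₁; inj₂)
open import Data.Empty using (⊥-elim)
open import Function using (_∘′_)
open import Function.Bundles using (Equivalence)
open import Relation.Nullary using (¬_)
open import Relation.Binary.Definitions using (tri<; tri≈; tri>)
open import Relation.Binary.PropositionalEquality

private variable
  A : Set
  σ : ℕ

≤ᵇ-true : ∀ {m n} → m ≤ n → (m ≤ᵇ n) ≡ true
≤ᵇ-true m≤n = Equivalence.to T-≡ (≤⇒≤ᵇ m≤n)

≤ᵇ-false : ∀ {m n} → n < m → (m ≤ᵇ n) ≡ false
≤ᵇ-false {m} {n} n<m = ¬-not (λ eq → <⇒≱ n<m (≤ᵇ⇒≤ m n (Equivalence.from T-≡ eq)))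

≤ᵇ-false⁻¹ : ∀ {m n} → (m ≤ᵇ n) ≡ false → n < m
≤ᵇ-false⁻¹ eq = ≰⇒> (subst T eq ∘′ ≤⇒≤ᵇ)

≤S-refl : (c : Sym σ) → (c ≤S c) ≡ true
≤S-refl dol     = refl
≤S-refl (chr a) = ≤ᵇ-true {toℕ a} ≤-refl

take-++ˡ : ∀ n (xs ys : List A) → n ≤ length xs → take n (xs ++ ys) ≡ take n xs
take-++ˡ zero    xs       ys _         = refl
take-++ˡ (suc n) (x ∷ xs) ys (s≤s n≤) = cong (x ∷_) (take-++ˡ n xs ys n≤)

take-++ʳ : ∀ n (xs ys : List A) → length xs ≤ n → take n (xs ++ ys) ≡ xs ++ take (n ∸ length xs) ys
take-++ʳ n       []       ys _         = refl
take-++ʳ (suc n) (x ∷ xs) ys (s≤s ≤n) = cong (x ∷_) (take-++ʳ n xs ys ≤n)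

drop-length-++ : ∀ (xs ys : List A) → drop (length xs) (xs ++ ys) ≡ ys
drop-length-++ []       ys = refl
drop-length-++ (x ∷ xs) ys = drop-length-++ xs ys

∈-take : ∀ {c : A} n xs → c ∈ take n xs → c ∈ xs
∈-take (suc n) (x ∷ xs) (here c≡x) = here c≡x
∈-take (suc n) (x ∷ xs) (there c∈) = there (∈-take n xs c∈)

∈-pow : ∀ {c : A} X k → c ∈ pow X k → c ∈ X
∈-pow X (suc k) c∈ with ∈-++⁻ X c∈
... | inj₁ c∈X   = c∈X
... | inj₂ c∈pow = ∈-pow X k c∈pow

pow-+ : ∀ (X : List A) m k → pow X (m + k) ≡ pow X m ++ pow X k
pow-+ X zero    k = refl
pow-+ X (suc m) k = trans (cong (X ++_) (pow-+ X m k)) (sym (++-assoc X (pow X m) (pow X k)))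

pow-* : ∀ (X : List A) a N → pow (pow X a) N ≡ pow X (a * N)
pow-* X a zero    rewrite *-zeroʳ a = refl
pow-* X a (suc N) rewrite *-suc a N = trans (cong (pow X a ++_) (pow-* X a N)) (sym (pow-+ X a (a * N)))

length-pow-≥ : ∀ (X : List A) N → X ≢ [] → N ≤ length (pow X N)
length-pow-≥ X       zero    _   = z≤n
length-pow-≥ []      (suc N) X≢[] = ⊥-elim (X≢[] refl)
length-pow-≥ (x ∷ X) (suc N) X≢[] =
  s≤s (≤-trans (length-pow-≥ (x ∷ X) N X≢[]) (length-++-≤ʳ _ {X}))

take-pow : ∀ (X : List A) {N K} → X ≢ [] → N ≤ K → take N (pow X K) ≡ take N (pow X N)
take-pow X {N} {K} X≢[] N≤K = begin
  take N (pow X K)                  ≡⟨ cong (take N ∘′ pow X) (sym (m+[n∸m]≡n N≤K)) ⟩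
  take N (pow X (N + (K ∸ N)))      ≡⟨ cong (take N) (pow-+ X N (K ∸ N)) ⟩
  take N (pow X N ++ pow X (K ∸ N)) ≡⟨ take-++ˡ N _ _ (length-pow-≥ X N X≢[]) ⟩
  take N (pow X N)                  ∎
  where open ≡-Reasoning

∈-remove : ∀ {z x : A} us vs → z ∈ us ++ x ∷ vs → z ≢ x → z ∈ us ++ vs
∈-remove []       vs (here refl) z≢x = ⊥-elim (z≢x refl)
∈-remove []       vs (there z∈)  _   = z∈
∈-remove (u ∷ us) vs (here z≡u)  _   = here z≡u
∈-remove (u ∷ us) vs (there z∈)  z≢x = there (∈-remove us vs z∈ z≢x)

Unique-⊆⇒length-≤ : ∀ {xs ys : List A} → Unique xs → xs ⊆ ys → length xs ≤ length ys
Unique-⊆⇒length-≤ {xs = []} _ _ = z≤n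
Unique-⊆⇒length-≤ {xs = x ∷ xs} (x∉xs ∷ xs-unique) x∷xs⊆ys with ∈-∃++ (x∷xs⊆ys (here refl))
... | us , vs , refl = subst (suc (length xs) ≤_) (sym (length-++-sucʳ us x vs))
  (s≤s (Unique-⊆⇒length-≤ xs-unique xs⊆us++vs))
  where
  xs⊆us++vs : xs ⊆ us ++ vs
  xs⊆us++vs z∈xs = ∈-remove us vs (x∷xs⊆ys (there z∈xs)) (λ z≡x → All.lookup x∉xs z∈xs (sym z≡x))

Unique-⊂⇒length-< : ∀ {xs ys : List A} {y} → Unique xs → xs ⊆ ys → y ∈ ys → y ∉ xs →
  length xs < length ys
Unique-⊂⇒length-< {xs = xs} xs-unique xs⊆ys y∈ys y∉xs = Unique-⊆⇒length-≤
  (All.tabulate (λ z∈xs y≡z → y∉xs (subst (_∈ xs) (sym y≡z) z∈xs)) ∷ xs-unique)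
  (λ { (here refl) → y∈ys ; (there z∈xs) → xs⊆ys z∈xs })

length-rot : ∀ k (X : List A) → length (rot k X) ≡ length X
length-rot zero    X = refl
length-rot (suc k) X with rot k X | length-rot k X
... | []     | |rot|≡ = |rot|≡
... | y ∷ ys | |rot|≡ =
  trans (length-++-sucʳ ys y []) (trans (cong (suc ∘′ length) (++-identityʳ ys)) |rot|≡)

rot-≢[] : ∀ k {X : List A} → X ≢ [] → rot k X ≢ []
rot-≢[] k {[]}    X≢[] _      = X≢[] refl
rot-≢[] k {x ∷ X} _    rot≡[] = 1+n≢0 (trans (sym (length-rot k (x ∷ X))) (cong length rot≡[]))

-- Prefix-distance arrays

pdGo-++ : ∀ (prev xs ys : Str σ) → pdGo prev (xs ++ ys) ≡ pdGo prev xs ++ pdGo (xs ʳ++ prev) ys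
pdGo-++ prev []       ys = refl
pdGo-++ prev (x ∷ xs) ys = cong (pdAt prev x ∷_) (pdGo-++ (x ∷ prev) xs ys)

pdGo-take : ∀ (prev : Str σ) n w → pdGo prev (take n w) ≡ take n (pdGo prev w)
pdGo-take prev zero    w       = refl
pdGo-take prev (suc n) []      = refl
pdGo-take prev (suc n) (x ∷ w) = cong (pdAt prev x ∷_) (pdGo-take (x ∷ prev) n w)

length-pdGo : ∀ (prev w : Str σ) → length (pdGo prev w) ≡ length w
length-pdGo prev []      = refl
length-pdGo prev (x ∷ w) = cong suc (length-pdGo (x ∷ prev) w)

Finite : PDSym → Set
Finite v = isInf v ≡ false

module _ (c : Sym σ) {y : Sym σ} (y≤c : (y ≤S c) ≡ true) where

  pdSearch-++ : ∀ P E d → y ∈ P → pdSearch c (P ++ E) d ≡ pdSearch c P d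
  pdSearch-++ (y′ ∷ P) E d (here refl) rewrite y≤c = refl
  pdSearch-++ (y′ ∷ P) E d (there y∈P) with y′ ≤S c
  ... | true  = refl
  ... | false = pdSearch-++ P E (suc d) y∈P

  pdSearch-finite : ∀ P d → y ∈ P → Finite (pdSearch c P d)
  pdSearch-finite (y′ ∷ P) d (here refl) rewrite y≤c = refl
  pdSearch-finite (y′ ∷ P) d (there y∈P) with y′ ≤S c
  ... | true  = refl
  ... | false = pdSearch-finite P (suc d) y∈P

-- Each symbol of w is found in P at the latest, so the search never reaches E.
pdGo-++-history : ∀ (P E w : Str σ) → w ⊆ P → pdGo (P ++ E) w ≡ pdGo P w
pdGo-++-history P E []          w⊆P = refl
pdGo-++-history P E (dol ∷ w)   w⊆P =
  cong (pdol ∷_) (pdGo-++-history (dol ∷ P) E w (there ∘′ w⊆P ∘′ there))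
pdGo-++-history P E (chr a ∷ w) w⊆P =
  cong₂ _∷_ (pdSearch-++ (chr a) (≤S-refl (chr a)) P E 1 (w⊆P (here refl)))
            (pdGo-++-history (chr a ∷ P) E w (there ∘′ w⊆P ∘′ there))

pdGo-finite : ∀ (P w : Str σ) → w ⊆ P → All Finite (pdGo P w)
pdGo-finite P []          w⊆P = []
pdGo-finite P (dol ∷ w)   w⊆P = refl ∷ pdGo-finite (dol ∷ P) w (there ∘′ w⊆P ∘′ there)
pdGo-finite P (chr a ∷ w) w⊆P = pdSearch-finite (chr a) (≤S-refl (chr a)) P 1 (w⊆P (here refl))
                               ∷ pdGo-finite (chr a ∷ P) w (there ∘′ w⊆P ∘′ there)

-- PD arrays of ω-prefixes

-- Entry i (from 0) of capFrom k has k + i symbols of history; a distance reaching past them becomes ∞.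
cap : ℕ → PDSym → PDSym
cap p (pnum m) = if m ≤ᵇ p then pnum m else pinf
cap p v        = v

capFrom : ℕ → List PDSym → List PDSym
capFrom k []       = []
capFrom k (v ∷ vs) = cap k v ∷ capFrom (suc k) vs

pdSearch-beyond : ∀ (c : Sym σ) E {d k} → k < d → cap k (pdSearch c E d) ≡ pinf
pdSearch-beyond c []      k<d = refl
pdSearch-beyond c (y ∷ E) k<d with y ≤S c
... | true rewrite ≤ᵇ-false k<d = refl
... | false = pdSearch-beyond c E (m<n⇒m<1+n k<d)

pdSearch-cap : ∀ (c : Sym σ) L E d → pdSearch c L (suc d) ≡ cap (d + length L) (pdSearch c (L ++ E) (suc d))
pdSearch-cap c []      E d = sym (pdSearch-beyond c E (s≤s (≤-reflexive (+-identityʳ d))))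
pdSearch-cap c (y ∷ L) E d with y ≤S c
... | true rewrite ≤ᵇ-true (m<m+n d {suc (length L)} z<s) = refl
... | false rewrite +-suc d (length L) = pdSearch-cap c L E (suc d)

pdGo-cap : ∀ (L E w : Str σ) → pdGo L w ≡ capFrom (length L) (pdGo (L ++ E) w)
pdGo-cap L E []          = refl
pdGo-cap L E (dol ∷ w)   = cong (pdol ∷_) (pdGo-cap (dol ∷ L) E w)
pdGo-cap L E (chr a ∷ w) = cong₂ _∷_ (pdSearch-cap (chr a) L E 0) (pdGo-cap (chr a ∷ L) E w)

RPD≡pdGo : ∀ (x : Str σ) → RPD x ≡ pdGo (reverse x) x
RPD≡pdGo x = begin
  drop (length x) (PD (x ++ x))
    ≡⟨ cong (drop (length x)) (pdGo-++ [] x x) ⟩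
  drop (length x) (PD x ++ pdGo (reverse x) x)
    ≡⟨ cong (λ k → drop k (PD x ++ pdGo (reverse x) x)) (sym (length-pdGo [] x)) ⟩
  drop (length (PD x)) (PD x ++ pdGo (reverse x) x)
    ≡⟨ drop-length-++ (PD x) _ ⟩
  pdGo (reverse x) x
    ∎
  where open ≡-Reasoning

length-RPD : ∀ (x : Str σ) → length (RPD x) ≡ length x
length-RPD x = trans (cong length (RPD≡pdGo x)) (length-pdGo (reverse x) x)

pdGo-pow : ∀ (x : Str σ) k → pdGo (reverse x) (pow x k) ≡ pow (RPD x) k
pdGo-pow x zero    = refl
pdGo-pow x (suc k) = begin
  pdGo (reverse x) (x ++ pow x k)
    ≡⟨ pdGo-++ (reverse x) x (pow x k) ⟩
  pdGo (reverse x) x ++ pdGo (x ʳ++ reverse x) (pow x k)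
    ≡⟨ cong₂ _++_ (sym (RPD≡pdGo x)) (cong (λ P → pdGo P (pow x k)) (ʳ++-defn x)) ⟩
  RPD x ++ pdGo (reverse x ++ reverse x) (pow x k)
    ≡⟨ cong (RPD x ++_) (pdGo-++-history (reverse x) (reverse x) (pow x k) (reverse⁺ ∘′ ∈-pow x k)) ⟩
  RPD x ++ pdGo (reverse x) (pow x k)
    ≡⟨ cong (RPD x ++_) (pdGo-pow x k) ⟩
  RPD x ++ pow (RPD x) k
    ∎
  where open ≡-Reasoning

ωPD : Str σ → ℕ → List PDSym
ωPD x N = PD (omegaPrefix x N)

ωPD-capFrom : ∀ (x : Str σ) N → ωPD x N ≡ capFrom 0 (take N (pow (RPD x) N))
ωPD-capFrom x N = begin
  PD (take N (pow x N))                            ≡⟨ pdGo-cap [] (reverse x) _ ⟩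
  capFrom 0 (pdGo (reverse x) (take N (pow x N)))  ≡⟨ cong (capFrom 0) (pdGo-take (reverse x) N (pow x N)) ⟩
  capFrom 0 (take N (pdGo (reverse x) (pow x N)))  ≡⟨ cong (capFrom 0 ∘′ take N) (pdGo-pow x N) ⟩
  capFrom 0 (take N (pow (RPD x) N))               ∎
  where open ≡-Reasoning

ωPD-root : ∀ {R} (x : Str σ) N → x ≢ [] → IsRoot R (RPD x) → ωPD x N ≡ capFrom 0 (take N (pow R N))
ωPD-root []      N x≢[] _ = ⊥-elim (x≢[] refl)
ωPD-root (c ∷ x) N _ (_ , zero , RPD≡[]) =
  ⊥-elim (1+n≢0 (trans (sym (length-RPD (c ∷ x))) (cong length RPD≡[])))
ωPD-root {R = R} x N _ ((R≢[] , _) , suc a , RPD≡Rᵃ) = begin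
  ωPD x N                                    ≡⟨ ωPD-capFrom x N ⟩
  capFrom 0 (take N (pow (RPD x) N))         ≡⟨ cong (λ X → capFrom 0 (take N (pow X N))) RPD≡Rᵃ ⟩
  capFrom 0 (take N (pow (pow R (suc a)) N)) ≡⟨ cong (capFrom 0 ∘′ take N) (pow-* R (suc a) N) ⟩
  capFrom 0 (take N (pow R (suc a * N)))     ≡⟨ cong (capFrom 0) (take-pow R R≢[] (m≤m+n N (a * N))) ⟩
  capFrom 0 (take N (pow R N))               ∎
  where open ≡-Reasoning

sameRoot⇒ωPD≡ : ∀ {x y : Str σ} → x ≢ [] → y ≢ [] → SameRoot (RPD x) (RPD y) →
  ∀ N → ωPD x N ≡ ωPD y N
sameRoot⇒ωPD≡ {x = x} {y} x≢[] y≢[] (R , R-root-x , R-root-y) N =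
  trans (ωPD-root x N x≢[] R-root-x) (sym (ωPD-root y N y≢[] R-root-y))

length-ωPD : ∀ (x : Str σ) N → x ≢ [] → length (ωPD x N) ≡ N
length-ωPD x N x≢[] = trans (length-pdGo [] (take N (pow x N)))
  (trans (length-take N (pow x N)) (m≤n⇒m⊓n≡m (length-pow-≥ x N x≢[])))

ωPD-prefix : ∀ (x : Str σ) {N N′} → x ≢ [] → N ≤ N′ → ωPD x N ≡ take N (ωPD x N′)
ωPD-prefix x {N} {N′} x≢[] N≤N′ = begin
  PD (take N (pow x N))               ≡⟨ cong PD (sym (take-pow x x≢[] N≤N′)) ⟩
  PD (take N (pow x N′))              ≡⟨ cong (λ k → PD (take k _)) (sym (m≤n⇒m⊓n≡m N≤N′)) ⟩
  PD (take (N ⊓ N′) (pow x N′))       ≡⟨ cong PD (sym (take-take N N′ (pow x N′))) ⟩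
  PD (take N (take N′ (pow x N′)))    ≡⟨ pdGo-take [] N _ ⟩
  take N (ωPD x N′)                   ∎
  where open ≡-Reasoning

-- Beyond the first period every symbol has an earlier occurrence, so no further ∞ appears.
ωPD-split : ∀ (x : Str σ) N → length x ≤ N → ∃ λ Z → ωPD x N ≡ PD x ++ Z × All Finite Z
ωPD-split []      zero    _      = [] , refl , []
ωPD-split x       (suc N) |x|≤N =
  pdGo (reverse x) w ,
  trans (cong PD (take-++ʳ (suc N) x (pow x N) |x|≤N)) (pdGo-++ [] x w) ,
  pdGo-finite (reverse x) w (reverse⁺ ∘′ ∈-pow x N ∘′ ∈-take _ _)
  where w = take (suc N ∸ length x) (pow x N)

-- Lexicographic order and longest common prefixes

<P-irrefl : ∀ {x} → ¬ x <P x
<P-irrefl (num<num m<m) = <-irrefl refl m<m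

<P-trans : ∀ {x y z} → x <P y → y <P z → x <P z
<P-trans dol<num       (num<num _)   = dol<num
<P-trans dol<num       num<inf       = dol<inf
<P-trans (num<num m<k) (num<num k<l) = num<num (<-trans m<k k<l)
<P-trans (num<num _)   num<inf       = num<inf

<P⇒≢ : ∀ {x y} → x <P y → x ≢ y
<P⇒≢ x<x refl = <P-irrefl x<x

<P-cmp : ∀ x y → x <P y ⊎ x ≡ y ⊎ y <P x
<P-cmp pdol     pdol     = inj₂ (inj₁ refl)
<P-cmp pdol     (pnum _) = inj₁ dol<num
<P-cmp pdol     pinf     = inj₁ dol<inf
<P-cmp (pnum _) pdol     = inj₂ (inj₂ dol<num)
<P-cmp (pnum m) (pnum k) with <-cmp m k
... | tri< m<k _ _    = inj₁ (num<num m<k)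
... | tri≈ _ refl _   = inj₂ (inj₁ refl)
... | tri> _ _ k<m    = inj₂ (inj₂ (num<num k<m))
<P-cmp (pnum _) pinf     = inj₁ num<inf
<P-cmp pinf     pdol     = inj₂ (inj₂ dol<inf)
<P-cmp pinf     (pnum _) = inj₂ (inj₂ num<inf)
<P-cmp pinf     pinf     = inj₂ (inj₁ refl)

LexLt-irrefl : ∀ {U} → ¬ LexLt U U
LexLt-irrefl (here x<x)  = <P-irrefl x<x
LexLt-irrefl (there U<U) = LexLt-irrefl U<U

LexLt-trans : ∀ {U V W} → LexLt U V → LexLt V W → LexLt U W
LexLt-trans prefix      (here _)    = prefix
LexLt-trans prefix      (there _)   = prefix
LexLt-trans (here x<y)  (here y<z)  = here (<P-trans x<y y<z)
LexLt-trans (here x<y)  (there _)   = here x<y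
LexLt-trans (there _)   (here y<z)  = here y<z
LexLt-trans (there U<V) (there V<W) = there (LexLt-trans U<V V<W)

LexLt-cmp : ∀ U V → length U ≡ length V → LexLt U V ⊎ U ≡ V ⊎ LexLt V U
LexLt-cmp []      []      _   = inj₂ (inj₁ refl)
LexLt-cmp (x ∷ U) (y ∷ V) |U|≡|V| with <P-cmp x y
... | inj₁ x<y        = inj₁ (here x<y)
... | inj₂ (inj₂ y<x) = inj₂ (inj₂ (here y<x))
... | inj₂ (inj₁ refl) with LexLt-cmp U V (suc-injective |U|≡|V|)
...   | inj₁ U<V        = inj₁ (there U<V)
...   | inj₂ (inj₁ refl) = inj₂ (inj₁ refl)
...   | inj₂ (inj₂ V<U) = inj₂ (inj₂ (there V<U))

LexLt-++ : ∀ {U V} → LexLt U V → length U ≡ length V → ∀ U′ V′ → LexLt (U ++ U′) (V ++ V′)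
LexLt-++ (here x<y)  _       U′ V′ = here x<y
LexLt-++ (there U<V) |U|≡|V| U′ V′ = there (LexLt-++ U<V (suc-injective |U|≡|V|) U′ V′)

LexLe : List PDSym → List PDSym → Set
LexLe U V = U ≡ V ⊎ LexLt U V

¬LexLt⇒LexLe : ∀ {U V} → length U ≡ length V → ¬ LexLt V U → LexLe U V
¬LexLt⇒LexLe {U} {V} |U|≡|V| V≮U with LexLt-cmp U V |U|≡|V|
... | inj₁ U<V        = inj₂ U<V
... | inj₂ (inj₁ U≡V) = inj₁ U≡V
... | inj₂ (inj₂ V<U) = ⊥-elim (V≮U V<U)

eqP-refl : ∀ x → eqP x x ≡ true
eqP-refl pdol     = refl
eqP-refl pinf     = refl
eqP-refl (pnum m) rewrite ≤ᵇ-true (≤-refl {m}) = refl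

eqP-sound : ∀ {x y} → eqP x y ≡ true → x ≡ y
eqP-sound {pdol}   {pdol}   _ = refl
eqP-sound {pinf}   {pinf}   _ = refl
eqP-sound {pnum m} {pnum k} _ with m ≤ᵇ k in m≤k | k ≤ᵇ m in k≤m
... | true | true =
  cong pnum (≤-antisym (≤ᵇ⇒≤ m k (subst T (sym m≤k) _)) (≤ᵇ⇒≤ k m (subst T (sym k≤m) _)))
eqP-sound {pdol}   {pnum _} ()
eqP-sound {pdol}   {pinf}   ()
eqP-sound {pnum _} {pdol}   ()
eqP-sound {pnum _} {pinf}   ()
eqP-sound {pinf}   {pdol}   ()
eqP-sound {pinf}   {pnum _} ()

eqP-sym : ∀ x y → eqP x y ≡ eqP y x
eqP-sym pdol     pdol     = refl
eqP-sym pdol     (pnum _) = refl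
eqP-sym pdol     pinf     = refl
eqP-sym (pnum _) pdol     = refl
eqP-sym (pnum m) (pnum k) = ∧-comm (m ≤ᵇ k) (k ≤ᵇ m)
eqP-sym (pnum _) pinf     = refl
eqP-sym pinf     pdol     = refl
eqP-sym pinf     (pnum _) = refl
eqP-sym pinf     pinf     = refl

lcp-∷ : ∀ x U V → lcp (x ∷ U) (x ∷ V) ≡ suc (lcp U V)
lcp-∷ x U V rewrite eqP-refl x = refl

lcp-∷-≢ : ∀ {x y} → x ≢ y → ∀ U V → lcp (x ∷ U) (y ∷ V) ≡ 0
lcp-∷-≢ {x} {y} x≢y U V with eqP x y in x=y
... | true  = ⊥-elim (x≢y (eqP-sound x=y))
... | false = refl

lcp-refl : ∀ U → lcp U U ≡ length U
lcp-refl []      = refl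
lcp-refl (x ∷ U) = trans (lcp-∷ x U U) (cong suc (lcp-refl U))

lcp-sym : ∀ U V → lcp U V ≡ lcp V U
lcp-sym []      []      = refl
lcp-sym []      (_ ∷ _) = refl
lcp-sym (_ ∷ _) []      = refl
lcp-sym (x ∷ U) (y ∷ V) rewrite eqP-sym x y with eqP y x
... | true  = cong suc (lcp-sym U V)
... | false = refl

lcp-≤ˡ : ∀ U V → lcp U V ≤ length U
lcp-≤ˡ []      V       = z≤n
lcp-≤ˡ (_ ∷ _) []      = z≤n
lcp-≤ˡ (x ∷ U) (y ∷ V) with eqP x y
... | true  = s≤s (lcp-≤ˡ U V)
... | false = z≤n

lcp-≤ʳ : ∀ U V → lcp U V ≤ length V
lcp-≤ʳ U V = subst (_≤ length V) (lcp-sym V U) (lcp-≤ˡ V U)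

take-lcp : ∀ U V → take (lcp U V) U ≡ take (lcp U V) V
take-lcp []      V       = refl
take-lcp (_ ∷ _) []      = refl
take-lcp (x ∷ U) (y ∷ V) with eqP x y in x=y
... | false = refl
... | true with eqP-sound {x} {y} x=y
...   | refl = cong (x ∷_) (take-lcp U V)

take-≤lcp : ∀ {l} U V → l ≤ lcp U V → take l U ≡ take l V
take-≤lcp {l} U V l≤lcp = begin
  take l U                   ≡⟨ cong (λ k → take k U) (sym (m≤n⇒m⊓n≡m l≤lcp)) ⟩
  take (l ⊓ lcp U V) U       ≡⟨ sym (take-take l (lcp U V) U) ⟩
  take l (take (lcp U V) U)  ≡⟨ cong (take l) (take-lcp U V) ⟩
  take l (take (lcp U V) V)  ≡⟨ take-take l (lcp U V) V ⟩
  take (l ⊓ lcp U V) V       ≡⟨ cong (λ k → take k V) (m≤n⇒m⊓n≡m l≤lcp) ⟩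
  take l V                   ∎
  where open ≡-Reasoning

lcp-ultrametric : ∀ U V W → lcp U V ≤ lcp U W ⊎ lcp V W ≤ lcp U W
lcp-ultrametric []      V       W       = inj₁ z≤n
lcp-ultrametric (_ ∷ _) []      W       = inj₁ z≤n
lcp-ultrametric (_ ∷ _) (_ ∷ _) []      = inj₂ z≤n
lcp-ultrametric (x ∷ U) (y ∷ V) (z ∷ W) with eqP x y in x=y
... | false = inj₁ z≤n
... | true with eqP-sound {x} {y} x=y
...   | refl with eqP x z in x=z
...     | false = inj₂ z≤n
...     | true with eqP-sound {x} {z} x=z
...       | refl with lcp-ultrametric U V W
...         | inj₁ le = inj₁ (s≤s le)
...         | inj₂ le = inj₂ (s≤s le)

LexLt-lcpˡ : ∀ {U V W} → LexLt U V → LexLt V W → lcp U W ≤ lcp U V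
LexLt-lcpˡ prefix _ = z≤n
LexLt-lcpˡ {_ ∷ U} {_ ∷ V} {_ ∷ W} (here x<y)  (here y<z)
  rewrite lcp-∷-≢ (<P⇒≢ (<P-trans x<y y<z)) U W = z≤n
LexLt-lcpˡ {_ ∷ U} {_ ∷ V} {_ ∷ W} (here x<y)  (there _)
  rewrite lcp-∷-≢ (<P⇒≢ x<y) U W = z≤n
LexLt-lcpˡ {_ ∷ U} {_ ∷ V} {_ ∷ W} (there _)   (here y<z)
  rewrite lcp-∷-≢ (<P⇒≢ y<z) U W = z≤n
LexLt-lcpˡ {x ∷ U} {_ ∷ V} {_ ∷ W} (there U<V) (there V<W)
  rewrite lcp-∷ x U W | lcp-∷ x U V = s≤s (LexLt-lcpˡ U<V V<W)

LexLt-lcpʳ : ∀ {U V W} → LexLt U V → LexLt V W → lcp U W ≤ lcp V W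
LexLt-lcpʳ prefix _ = z≤n
LexLt-lcpʳ {_ ∷ U} {_ ∷ V} {_ ∷ W} (here x<y)  (here y<z)
  rewrite lcp-∷-≢ (<P⇒≢ (<P-trans x<y y<z)) U W = z≤n
LexLt-lcpʳ {_ ∷ U} {_ ∷ V} {_ ∷ W} (here x<y)  (there _)
  rewrite lcp-∷-≢ (<P⇒≢ x<y) U W = z≤n
LexLt-lcpʳ {_ ∷ U} {_ ∷ V} {_ ∷ W} (there _)   (here y<z)
  rewrite lcp-∷-≢ (<P⇒≢ y<z) U W = z≤n
LexLt-lcpʳ {x ∷ U} {_ ∷ V} {_ ∷ W} (there U<V) (there V<W)
  rewrite lcp-∷ x U W | lcp-∷ x V W = s≤s (LexLt-lcpʳ U<V V<W)

LexLe-lcpˡ : ∀ {U V W} → LexLe U V → LexLe V W → lcp U W ≤ lcp U V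
LexLe-lcpˡ {U} {W = W} (inj₁ refl) _ = subst (lcp U W ≤_) (sym (lcp-refl U)) (lcp-≤ˡ U W)
LexLe-lcpˡ (inj₂ _)   (inj₁ refl) = ≤-refl
LexLe-lcpˡ (inj₂ U<V) (inj₂ V<W)  = LexLt-lcpˡ U<V V<W

LexLe-lcpʳ : ∀ {U V W} → LexLe U V → LexLe V W → lcp U W ≤ lcp V W
LexLe-lcpʳ (inj₁ refl) _ = ≤-refl
LexLe-lcpʳ {U} {V} (inj₂ _) (inj₁ refl) = subst (lcp U V ≤_) (sym (lcp-refl V)) (lcp-≤ʳ U V)
LexLe-lcpʳ (inj₂ U<V) (inj₂ V<W) = LexLt-lcpʳ U<V V<W

-- Counting ∞ in common prefixes

lcpRank : List PDSym → List PDSym → ℕ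
lcpRank U V = rankInf U (lcp U V)

rankInf-mono : ∀ U {l l′} → l ≤ l′ → rankInf U l ≤ rankInf U l′
rankInf-mono U       {zero}              _         = z≤n
rankInf-mono []      {suc _} {suc _}     _         = z≤n
rankInf-mono (x ∷ U) {suc l} {suc l′}    (s≤s l≤l′) with isInf x
... | true  = s≤s (rankInf-mono U l≤l′)
... | false = rankInf-mono U l≤l′

rankInf-≤ : ∀ U V {l l′} → l ≤ lcp U V → l ≤ l′ → rankInf U l ≤ rankInf V l′
rankInf-≤ U V {l} {l′} l≤lcp l≤l′ =
  subst (_≤ rankInf V l′) (cong countInf (sym (take-≤lcp U V l≤lcp))) (rankInf-mono V l≤l′)

lcpRank-sym : ∀ U V → lcpRank U V ≡ lcpRank V U
lcpRank-sym U V = trans (cong countInf (take-lcp U V)) (cong (rankInf V) (lcp-sym U V))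

rankInf-finite : ∀ {Z} l → All Finite Z → rankInf Z l ≡ 0
rankInf-finite zero    _                  = refl
rankInf-finite (suc l) []                 = refl
rankInf-finite (suc l) (z-finite ∷ Z-finite) rewrite z-finite = rankInf-finite l Z-finite

lcpRank-++-finite : ∀ P P′ {Z Z′} → All Finite Z → All Finite Z′ →
  lcpRank (P ++ Z) (P′ ++ Z′) ≡ lcpRank P P′
lcpRank-++-finite []      P′       {Z} {Z′} Z-finite _ = rankInf-finite (lcp Z (P′ ++ Z′)) Z-finite
lcpRank-++-finite (p ∷ P) []       {Z} {Z′} _ Z′-finite =
  trans (cong countInf (take-lcp (p ∷ P ++ Z) Z′)) (rankInf-finite (lcp (p ∷ P ++ Z) Z′) Z′-finite)
lcpRank-++-finite (p ∷ P) (p′ ∷ P′) Z-finite Z′-finite with eqP p p′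
... | false = refl
... | true  = cong (λ r → if isInf p then suc r else r) (lcpRank-++-finite P P′ Z-finite Z′-finite)

lcpcount≡lcpRank-ωPD : ∀ {x y : Str σ} N → length x ≤ N → length y ≤ N →
  lcpcount x y ≡ lcpRank (ωPD x N) (ωPD y N)
lcpcount≡lcpRank-ωPD {x = x} {y} N |x|≤N |y|≤N
  with ωPD-split x N |x|≤N | ωPD-split y N |y|≤N
... | Z , x≡ , Z-finite | Z′ , y≡ , Z′-finite =
  sym (trans (cong₂ lcpRank x≡ y≡) (lcpRank-++-finite (PD x) (PD y) Z-finite Z′-finite))

adjacent-lcp-≤ : ∀ (A : ℕ → List PDSym) {i j} → i < j →
  ∃ λ m → i ≤ m × m < j × lcp (A m) (A (suc m)) ≤ lcp (A i) (A j)
adjacent-lcp-≤ A {i} {suc j} (s≤s i≤j) with m≤n⇒m<n∨m≡n i≤j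
... | inj₂ refl = i , ≤-refl , n<1+n i , ≤-refl
... | inj₁ i<j with adjacent-lcp-≤ A i<j | lcp-ultrametric (A i) (A j) (A (suc j))
...   | m , i≤m , m<j , lcp≤ | inj₁ le = m , i≤m , m<n⇒m<1+n m<j , ≤-trans lcp≤ le
...   | _                    | inj₂ le = j , i≤j , n<1+n j , le

module SortedLcp (A : ℕ → List PDSym) (i j : ℕ)
  (sorted : ∀ {m m′} → i ≤ m → m ≤ m′ → m′ ≤ j → LexLe (A m) (A m′)) where

  lcp-≤-inner : ∀ {m} → i ≤ m → m ≤ j → lcp (A i) (A j) ≤ lcp (A i) (A m)
  lcp-≤-inner i≤m m≤j = LexLe-lcpˡ (sorted ≤-refl i≤m m≤j) (sorted i≤m m≤j ≤-refl)

  lcp-≤-adjacent : ∀ {m} → i ≤ m → m < j → lcp (A i) (A j) ≤ lcp (A m) (A (suc m))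
  lcp-≤-adjacent i≤m m<j = ≤-trans (lcp-≤-inner (m≤n⇒m≤1+n i≤m) m<j)
    (LexLe-lcpʳ (sorted ≤-refl i≤m (<⇒≤ m<j)) (sorted i≤m (n≤1+n _) m<j))

  lcpRank-≤-adjacent : ∀ {m} → i ≤ m → m < j → lcpRank (A i) (A j) ≤ lcpRank (A m) (A (suc m))
  lcpRank-≤-adjacent i≤m m<j =
    rankInf-≤ (A i) (A _) (lcp-≤-inner i≤m (<⇒≤ m<j)) (lcp-≤-adjacent i≤m m<j)

  lcpRank-attained : i < j → ∃ λ m → i ≤ m × m < j × lcpRank (A m) (A (suc m)) ≡ lcpRank (A i) (A j)
  lcpRank-attained i<j with adjacent-lcp-≤ A i<j
  ... | m , i≤m , m<j , lcp≤ = m , i≤m , m<j ,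
    ≤-antisym (rankInf-≤ (A m) (A i) lcp≤lcp lcp≤) (lcpRank-≤-adjacent i≤m m<j)
    where
    lcp≤lcp : lcp (A m) (A (suc m)) ≤ lcp (A m) (A i)
    lcp≤lcp = subst (_ ≤_) (lcp-sym (A i) (A m)) (≤-trans lcp≤ (lcp-≤-inner i≤m (<⇒≤ m<j)))

-- The ω-order

-- The first disjunct of _⪯ω_.
_⊏ω_ : Str σ → Str σ → Set
x ⊏ω y = ∃ λ N → LexLt (ωPD x N) (ωPD y N)

module _ {x y : Str σ} (x≢[] : x ≢ []) (y≢[] : y ≢ []) where

  ωPD-LexLt-extend : ∀ {N N′} → LexLt (ωPD x N) (ωPD y N) → N ≤ N′ →
    LexLt (ωPD x N′) (ωPD y N′)
  ωPD-LexLt-extend {N} {N′} x<y N≤N′ =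
    subst₂ LexLt (split x x≢[]) (split y y≢[])
      (LexLt-++ x<y (trans (length-ωPD x N x≢[]) (sym (length-ωPD y N y≢[]))) _ _)
    where
    split : ∀ z → z ≢ [] → ωPD z N ++ drop N (ωPD z N′) ≡ ωPD z N′
    split z z≢[] =
      trans (cong (_++ drop N (ωPD z N′)) (ωPD-prefix z z≢[] N≤N′)) (take++drop≡id N (ωPD z N′))

⊏ω-trans : ∀ {x y z : Str σ} → x ≢ [] → y ≢ [] → z ≢ [] → x ⊏ω y → y ⊏ω z → x ⊏ω z
⊏ω-trans x≢[] y≢[] z≢[] (N , x<y) (N′ , y<z) = N ⊔ N′ , LexLt-trans
  (ωPD-LexLt-extend x≢[] y≢[] x<y (m≤m⊔n N N′))
  (ωPD-LexLt-extend y≢[] z≢[] y<z (m≤n⊔m N N′))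

⊏ω-irrefl : ∀ {x : Str σ} → ¬ x ⊏ω x
⊏ω-irrefl (_ , x<x) = LexLt-irrefl x<x

⊏ω-respˡ : ∀ {x y z : Str σ} → (∀ N → ωPD x N ≡ ωPD y N) → y ⊏ω z → x ⊏ω z
⊏ω-respˡ x≡y (N , y<z) = N , subst (λ U → LexLt U _) (sym (x≡y N)) y<z

⪯ω-⊏ω-trans : ∀ {x y z : Str σ} → x ≢ [] → y ≢ [] → z ≢ [] → x ⪯ω y → y ⊏ω z → x ⊏ω z
⪯ω-⊏ω-trans x≢[] y≢[] z≢[] (inj₁ x⊏y)    y⊏z = ⊏ω-trans x≢[] y≢[] z≢[] x⊏y y⊏z
⪯ω-⊏ω-trans x≢[] y≢[] _    (inj₂ x~y) y⊏z = ⊏ω-respˡ (sameRoot⇒ωPD≡ x≢[] y≢[] x~y) y⊏z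

⊏ω⇒≺ω : ∀ {x y : Str σ} → x ≢ [] → y ≢ [] → x ⊏ω y → x ≺ω y
⊏ω⇒≺ω x≢[] y≢[] x⊏y = inj₁ x⊏y , λ
  { (_ , inj₁ y⊏x) → ⊏ω-irrefl (⊏ω-trans x≢[] y≢[] x≢[] x⊏y y⊏x)
  ; (_ , inj₂ y~x) → ⊏ω-irrefl (⊏ω-respˡ (sameRoot⇒ωPD≡ y≢[] x≢[] y~x) x⊏y) }

≺ω-irrefl : ∀ {x : Str σ} → ¬ x ≺ω x
≺ω-irrefl (x⪯x , x≠x) = x≠x (x⪯x , x⪯x)

-- The conjugate array

conj-bounds : ∀ (𝒯 : List (Str σ)) {t} → All (λ T → T ≢ []) 𝒯 → 1 ≤ t → t ≤ totalLength 𝒯 →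
  conj 𝒯 t ≢ [] × length (conj 𝒯 t) ≤ totalLength 𝒯
conj-bounds []      []             (s≤s _) ()
conj-bounds (T ∷ 𝒯) {t} (T≢[] ∷ 𝒯≢[]) 1≤t t≤n with t ≤ᵇ length T in t≤|T|
... | true =
  rot-≢[] (t ∸ 1) T≢[] ,
  subst (_≤ length T + totalLength 𝒯) (sym (length-rot (t ∸ 1) T)) (m≤m+n _ _)
... | false =
  let conj≢[] , |conj|≤ = conj-bounds 𝒯 𝒯≢[] (m<n⇒0<n∸m (≤ᵇ-false⁻¹ {t} t≤|T|))
                            (subst (t ∸ length T ≤_) (m+n∸m≡n (length T) _) (∸-monoˡ-≤ (length T) t≤n))
  in conj≢[] , ≤-trans |conj|≤ (m≤n+m _ _)

module ConjugateArray {σ} (𝒯 : List (Str σ)) (𝒯≢[] : All (λ T → T ≢ []) 𝒯)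
                      (CA : ℕ → ℕ) (isCA : IsCA 𝒯 CA) where

  n : ℕ
  n = totalLength 𝒯

  S : ℕ → Str σ
  S k = conj 𝒯 (CA k)

  Sω : ℕ → List PDSym
  Sω k = ωPD (S k) n

  precedes : ℕ → ℕ → Set
  precedes b t = (conj 𝒯 t ≺ω conj 𝒯 b) ⊎ ((conj 𝒯 t =ω conj 𝒯 b) × t < b)

  precedes⇒⪯ω : ∀ {b t} → precedes b t → conj 𝒯 t ⪯ω conj 𝒯 b
  precedes⇒⪯ω (inj₁ (t⪯b , _))      = t⪯b
  precedes⇒⪯ω (inj₂ ((t⪯b , _) , _)) = t⪯b

  module _ {k} (1≤k : 1 ≤ k) (k≤n : k ≤ n) where

    CA-bounds : 1 ≤ CA k × CA k ≤ n
    CA-bounds = proj₁ isCA k 1≤k k≤n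

    S-bounds : S k ≢ [] × length (S k) ≤ n
    S-bounds = conj-bounds 𝒯 𝒯≢[] (proj₁ CA-bounds) (proj₂ CA-bounds)

    length-Sω : length (Sω k) ≡ n
    length-Sω = length-ωPD (S k) n (proj₁ S-bounds)

    predecessors : CardIs n (precedes (CA k)) (k ∸ 1)
    predecessors = Equivalence.to (proj₂ isCA k (CA k) 1≤k k≤n (proj₁ CA-bounds) (proj₂ CA-bounds)) refl

  -- If S k′ ⊏ω S k, every predecessor of CA k′ precedes CA k, and so does CA k′ itself.
  ⊏ω⇒index-< : ∀ {k k′} → 1 ≤ k → k ≤ n → 1 ≤ k′ → k′ ≤ n → S k′ ⊏ω S k → k′ < k
  ⊏ω⇒index-< {suc k} {suc k′} 1≤k k≤n 1≤k′ k′≤n S′⊏S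
    with predecessors 1≤k k≤n | predecessors 1≤k′ k′≤n
  ... | ks , _ , ks-spec , |ks|≡k | ks′ , ks′-unique , ks′-spec , |ks′|≡k′ =
    s≤s (subst₂ _<_ |ks′|≡k′ |ks|≡k (Unique-⊂⇒length-< ks′-unique ks′⊆ks CA-k′∈ks CA-k′∉ks′))
    where
    S≢[] : S (suc k) ≢ []
    S≢[] = proj₁ (S-bounds 1≤k k≤n)
    S′≢[] : S (suc k′) ≢ []
    S′≢[] = proj₁ (S-bounds 1≤k′ k′≤n)

    ks′⊆ks : ks′ ⊆ ks
    ks′⊆ks {t} t∈ks′ with Equivalence.to (ks′-spec t) t∈ks′
    ... | t-range@(1≤t , t≤n) , t-precedes = Equivalence.from (ks-spec t)
      (t-range , inj₁ (⊏ω⇒≺ω t≢[] S≢[] (⪯ω-⊏ω-trans t≢[] S′≢[] S≢[] (precedes⇒⪯ω t-precedes) S′⊏S)))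
      where
      t≢[] : conj 𝒯 t ≢ []
      t≢[] = proj₁ (conj-bounds 𝒯 𝒯≢[] 1≤t t≤n)

    CA-k′∈ks : CA (suc k′) ∈ ks
    CA-k′∈ks = Equivalence.from (ks-spec (CA (suc k′)))
      (CA-bounds 1≤k′ k′≤n , inj₁ (⊏ω⇒≺ω S′≢[] S≢[] S′⊏S))

    CA-k′∉ks′ : CA (suc k′) ∉ ks′
    CA-k′∉ks′ CA-k′∈ks′ with proj₂ (Equivalence.to (ks′-spec (CA (suc k′))) CA-k′∈ks′)
    ... | inj₁ S′≺S′      = ≺ω-irrefl S′≺S′
    ... | inj₂ (_ , CA<CA) = <-irrefl refl CA<CA

  Sω-sorted : ∀ {k k′} → 1 ≤ k → k ≤ k′ → k′ ≤ n → LexLe (Sω k) (Sω k′)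
  Sω-sorted {k} {k′} 1≤k k≤k′ k′≤n =
    ¬LexLt⇒LexLe (trans (length-Sω 1≤k k≤n) (sym (length-Sω 1≤k′ k′≤n)))
      (λ Sω′<Sω → <⇒≱ (⊏ω⇒index-< 1≤k k≤n 1≤k′ k′≤n (n , Sω′<Sω)) k≤k′)
    where
    k≤n : k ≤ n
    k≤n = ≤-trans k≤k′ k′≤n
    1≤k′ : 1 ≤ k′
    1≤k′ = ≤-trans 1≤k k≤k′

  lcpcount≡lcpRank : ∀ {k k′} → 1 ≤ k → k ≤ n → 1 ≤ k′ → k′ ≤ n →
    lcpcount (S k) (S k′) ≡ lcpRank (Sω k) (Sω k′)
  lcpcount≡lcpRank 1≤k k≤n 1≤k′ k′≤n =
    lcpcount≡lcpRank-ωPD n (proj₂ (S-bounds 1≤k k≤n)) (proj₂ (S-bounds 1≤k′ k′≤n))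

  LCPinf≡lcpRank : ∀ {m} → 1 ≤ m → m < n → LCPinf 𝒯 CA (suc m) ≡ lcpRank (Sω m) (Sω (suc m))
  LCPinf≡lcpRank {suc m} 1≤m m<n =
    trans (lcpcount≡lcpRank (s≤s z≤n) m<n 1≤m (<⇒≤ m<n)) (lcpRank-sym (Sω (suc (suc m))) (Sω (suc m)))

lemma13 : ∀ {σ : ℕ} (𝒯 : List (Str σ)) → 𝒯 ≢ [] → All (λ T → T ≢ []) 𝒯 → Unique 𝒯 →
    (CA : ℕ → ℕ) → IsCA 𝒯 CA →
    ∀ (i j : ℕ) → 1 ≤ i → i < j → j ≤ totalLength 𝒯 →
      IsMinOn (LCPinf 𝒯 CA) (suc i) j (lcpcount (conj 𝒯 (CA i)) (conj 𝒯 (CA j)))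
      × IsRNV (LCPinf 𝒯 CA) (suc i) j (-[1+ 0 ]) (lcpcount (conj 𝒯 (CA i)) (conj 𝒯 (CA j)))
lemma13 𝒯 _ 𝒯≢[] _ CA isCA i j 1≤i i<j j≤n =
  (attained , lower-bound) , (attained , -<+ , λ k i<k k≤j _ → lower-bound k i<k k≤j)
  where
  open ConjugateArray 𝒯 𝒯≢[] CA isCA
  open SortedLcp Sω i j (λ i≤m m≤m′ m′≤j → Sω-sorted (≤-trans 1≤i i≤m) m≤m′ (≤-trans m′≤j j≤n))

  value≡ : lcpcount (S i) (S j) ≡ lcpRank (Sω i) (Sω j)
  value≡ = lcpcount≡lcpRank 1≤i (≤-trans (<⇒≤ i<j) j≤n) (≤-trans 1≤i (<⇒≤ i<j)) j≤n

  LCPinf≡ : ∀ {m} → i ≤ m → m < j → LCPinf 𝒯 CA (suc m) ≡ lcpRank (Sω m) (Sω (suc m))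
  LCPinf≡ i≤m m<j = LCPinf≡lcpRank (≤-trans 1≤i i≤m) (<-≤-trans m<j j≤n)

  lower-bound : ∀ k → suc i ≤ k → k ≤ j → lcpcount (S i) (S j) ≤ LCPinf 𝒯 CA k
  lower-bound (suc m) (s≤s i≤m) m<j =
    subst₂ _≤_ (sym value≡) (sym (LCPinf≡ i≤m m<j)) (lcpRank-≤-adjacent i≤m m<j)

  attained : ∃ λ k → suc i ≤ k × k ≤ j × LCPinf 𝒯 CA k ≡ lcpcount (S i) (S j)
  attained with lcpRank-attained i<j
  ... | m , i≤m , m<j , adjacent≡ =
    suc m , s≤s i≤m , m<j , trans (LCPinf≡ i≤m m<j) (trans adjacent≡ (sym value≡))
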